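{- Let $G$ be a connected graph that is not a clique and that has a min-max clique covering with simple intersection, and let $\mathcal{C}(G)$ be its compressed cliques graph. Then \[ |V(G)|-Z_+(G)=|V(\mathcal{C}(G))|-Z_+(\mathcal{C}(G)). \] Moreover, there exist positive zero forcing processes (from optimal positive zero forcing sets) on $G$ and on $\mathcal{C}(G)$ whose collections of forcing trees differ only in that the collection for $G$ may contain additional forcing trees consisting of single isolated vertices.
   Context: A clique is a set of vertices inducing a complete subgraph; maximal if no vertex can be added. A clique covering is a set of cliques such that every edge lies inside one of them; $\mathrm{cc}(G)$ is the minimum size of a clique covering; a min-max clique covering is one of size $\mathrm{cc}(G)$ all of whose cliques are maximal. A covering $\{C_1,\dots,C_\ell\}$ has simple intersection if no vertex lies in three distinct $C_i$. For such a covering define, for $i\neq j$, $C_{i,j}=C_i\cap C_j$, and $C_{i,i}=C_i\setminus\bigcup_{j\neq i}C_j$. The compressed cliques graph $\mathcal{C}(G)$ has one vertex $v_{i,j}$ for each nonempty $C_{i,j}$ (unordered pairs, $i=j$ allowed), distinct $v_{i,j},v_{i',j'}$ adjacent iff $\{i,j\}\cap\{i',j'\}\neq\emptyset$ (unique up to isomorphism). Positive zero forcing: a set $B$ of vertices is coloured black, the rest white. Positive colour change rule: let $W_1,\dots,W_k$ be the vertex sets of the connected components of $G-B$ ($B$ the current black set); if $u\in B$ and $w$ is the only white neighbour of $u$ in $G[W_i\cup B]$, then $u$ forces $w$ (colours it black). A set $S$ is a positive zero forcing set if starting with $S$ black, repeated application colours all vertices black; $Z_+(G)$ is the minimum size of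 such a set. Recording which vertex forces which yields a partition of the vertices into rooted trees (forcing trees), rooted at the initially black vertices. -}

module Defs where

open import Data.Nat using (ℕ; _∸_) renaming (_≤_ to _≤ℕ_)
open import Data.Fin using (Fin) renaming (_≤_ to _≤F_)
open import Data.Fin.Subset using (Subset; _∈_; _∉_; ∣_∣; _∪_; ⁅_⁆)
open import Data.List using (List; map)
open import Data.List.Membership.Propositional using () renaming (_∈_ to _∈ₗ_)
open import Data.Product using (Σ; ∃; _×_; _,_; proj₁; proj₂)
open import Data.Sum using (_⊎_)
open import Data.Unit using (⊤)
open import Data.Empty using (⊥)
open import Relation.Nullary using (¬_; Dec)
open import Relation.Binary.PropositionalEquality using (_≡_; _≢_)

record Graph : Set₁ where
  field
    n     : ℕ
    _~_   : Fin n → Fin n → Set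
    ~-sym : ∀ {u v} → u ~ v → v ~ u
    ~-irr : ∀ {u} → ¬ (u ~ u)
    ~-dec : ∀ u v → Dec (u ~ v)

open Graph public

data Reach (G : Graph) (P : Fin (n G) → Set) : Fin (n G) → Fin (n G) → Set where
  here : ∀ {v} → P v → Reach G P v v
  step : ∀ {u v w} → P u → _~_ G u v → Reach G P v w → Reach G P u w

Connected : Graph → Set
Connected G = ∀ u v → Reach G (λ _ → ⊤) u v

IsCompleteGraph : Graph → Set
IsCompleteGraph G = ∀ u v → u ≢ v → _~_ G u v

IsClique : (G : Graph) → Subset (n G) → Set
IsClique G C = ∀ u v → u ∈ C → v ∈ C → u ≢ v → _~_ G u v

IsMaximalClique : (G : Graph) → Subset (n G) → Set
IsMaximalClique G C = IsClique G C × (∀ w → w ∉ C → ¬ IsClique G (C ∪ ⁅ w ⁆))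

IsCliqueCovering : (G : Graph) (ℓ : ℕ) → (Fin ℓ → Subset (n G)) → Set
IsCliqueCovering G ℓ C =
  (∀ i → IsClique G (C i)) ×
  (∀ u v → _~_ G u v → ∃ λ i → u ∈ C i × v ∈ C i)

IsMinMaxCliqueCovering : (G : Graph) (ℓ : ℕ) → (Fin ℓ → Subset (n G)) → Set
IsMinMaxCliqueCovering G ℓ C =
  IsCliqueCovering G ℓ C ×
  (∀ ℓ' (C' : Fin ℓ' → Subset (n G)) → IsCliqueCovering G ℓ' C' → ℓ ≤ℕ ℓ') ×
  (∀ i → IsMaximalClique G (C i))

SimpleIntersection : (G : Graph) (ℓ : ℕ) → (Fin ℓ → Subset (n G)) → Set
SimpleIntersection G ℓ C =
  ∀ v i j k → i ≢ j → j ≢ k → i ≢ k → v ∈ C i → v ∈ C j → v ∈ C k → ⊥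

InCij : (G : Graph) (ℓ : ℕ) → (Fin ℓ → Subset (n G)) → Fin ℓ → Fin ℓ → Fin (n G) → Set
InCij G ℓ C i j v =
  (i ≡ j × v ∈ C i × (∀ k → k ≢ i → v ∉ C k)) ⊎
  (i ≢ j × v ∈ C i × v ∈ C j)

SharesIndex : ∀ {ℓ} → Fin ℓ × Fin ℓ → Fin ℓ × Fin ℓ → Set
SharesIndex (i , j) (i' , j') = i ≡ i' ⊎ i ≡ j' ⊎ j ≡ i' ⊎ j ≡ j'

-- H is (isomorphic to) the compressed cliques graph of G w.r.t. C:
-- its vertices are in bijection (via lab) with the unordered pairs {i,j}
-- (represented as i ≤ j) with C_{i,j} nonempty, and distinct vertices are
-- adjacent iff their pairs share an index.
record IsCompressedCliquesGraph (G : Graph) (ℓ : ℕ) (C : Fin ℓ → Subset (n G)) (H : Graph) : Set where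
  field
    lab          : Fin (n H) → Fin ℓ × Fin ℓ
    lab-ordered  : ∀ x → proj₁ (lab x) ≤F proj₂ (lab x)
    lab-nonempty : ∀ x → ∃ λ v → InCij G ℓ C (proj₁ (lab x)) (proj₂ (lab x)) v
    lab-injective : ∀ x y → lab x ≡ lab y → x ≡ y
    lab-surjective : ∀ i j → i ≤F j → (∃ λ v → InCij G ℓ C i j v) → ∃ λ x → lab x ≡ (i , j)
    adj⇒ : ∀ x y → _~_ H x y → x ≢ y × SharesIndex (lab x) (lab y)
    adj⇐ : ∀ x y → x ≢ y → SharesIndex (lab x) (lab y) → _~_ H x y

-- u forces w w.r.t. current black set B (positive colour change rule):
-- w is the only white neighbour of u within G[W ∪ B], W the component of
-- G - B containing w.
ValidForce : (G : Graph) → (Fin (n G) → Set) → Fin (n G) → Fin (n G) → Set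
ValidForce G B u w =
  B u × ¬ B w × _~_ G u w ×
  (∀ w' → ¬ B w' → _~_ G u w' → Reach G (λ x → ¬ B x) w w' → w' ≡ w)

ForcingSeq : (G : Graph) → (Fin (n G) → Set) → List (Fin (n G) × Fin (n G)) → Set
ForcingSeq G B List.[] = ⊤
ForcingSeq G B ((u , w) List.∷ fs) = ValidForce G B u w × ForcingSeq G (λ v → B v ⊎ v ≡ w) fs

IsPZFProcess : (G : Graph) → Subset (n G) → List (Fin (n G) × Fin (n G)) → Set
IsPZFProcess G S fs =
  ForcingSeq G (λ v → v ∈ S) fs × (∀ v → v ∈ S ⊎ v ∈ₗ map proj₂ fs)

IsPZFSet : (G : Graph) → Subset (n G) → Set
IsPZFSet G S = ∃ λ fs → IsPZFProcess G S fs

IsZplus : Graph → ℕ → Set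
IsZplus G k = (∃ λ S → ∣ S ∣ ≡ k × IsPZFSet G S) × (∀ S → IsPZFSet G S → k ≤ℕ ∣ S ∣)

Forces : (G : Graph) → List (Fin (n G) × Fin (n G)) → Fin (n G) → Fin (n G) → Set
Forces G fs u w = (u , w) ∈ₗ fs

-- The forcing trees of (SG, fsG) on G are those of (SH, fsH) on H (as
-- rooted trees, via the vertex embedding ψ), plus forcing trees in G
-- consisting of a single isolated vertex (initially black, forcing nothing).
SameForcingTreesUpToSingletons :
  (G H : Graph) → Subset (n G) → List (Fin (n G) × Fin (n G)) →
  Subset (n H) → List (Fin (n H) × Fin (n H)) → Set
SameForcingTreesUpToSingletons G H SG fsG SH fsH =
  Σ (Fin (n H) → Fin (n G)) λ ψ →
    (∀ x y → ψ x ≡ ψ y → x ≡ y) ×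
    (∀ x → (x ∈ SH → ψ x ∈ SG) × (ψ x ∈ SG → x ∈ SH)) ×
    (∀ x y → (Forces H fsH x y → Forces G fsG (ψ x) (ψ y)) ×
             (Forces G fsG (ψ x) (ψ y) → Forces H fsH x y)) ×
    (∀ v → (∀ x → ψ x ≢ v) → v ∈ SG × (∀ w → ¬ Forces G fsG v w))

-- Under simple intersection every vertex of G lies in exactly one cell C_{i,j}, and two distinct
-- vertices are adjacent iff their cells are equal or adjacent in 𝒞(G): G is 𝒞(G) with every vertex
-- blown up into a clique of closed twins. In a positive zero forcing process on G a force always
-- colours the last white vertex of its twin class, so each class holds at most one initially white
-- vertex, and projecting class by class yields a process on 𝒞(G) with at least as many white
-- vertices. Conversely a process on 𝒞(G) runs on the class representatives in G once all other
-- vertices start black; this only adds singleton forcing trees and keeps the number of white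
-- vertices.

module Submission where

open import Defs
open import Data.Nat using (ℕ; _∸_; zero; suc; _≤_; s≤s; z≤n)
import Data.Nat.Properties as ℕ
open import Data.Fin using (Fin; zero; suc) renaming (_≤_ to _≤F_)
import Data.Fin.Properties as Fin
open import Data.Fin.Subset using (Subset; ∣_∣; _∈_; _∉_; ∁; _-_; inside; outside)
open import Data.Fin.Subset.Properties
  using (_∈?_; ∣∁p∣≡n∸∣p∣; ∣p∣≤n; x∈∁p⇒x∉p; x∉p⇒x∈∁p; x∈p⇒∣p-x∣<∣p∣; x∈p∧x≢y⇒x∈p-y)
open import Data.Vec using ([]; _∷_; here; there)
open import Data.List using ([]; _∷_; map)
open import Data.List.Membership.Propositional using () renaming (_∈_ to _∈ₗ_)
import Data.List.Relation.Unary.Any as Any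
open import Data.List.Membership.Propositional.Properties using (∈-map⁺; ∈-map⁻)
open import Data.Product using (∃; _×_; _,_; proj₁; proj₂)
open import Data.Sum using (_⊎_; inj₁; inj₂)
open import Data.Empty using (⊥; ⊥-elim)
open import Data.Unit using (tt)
open import Relation.Nullary using (¬_; Dec; yes; no; does)
open import Relation.Nullary.Decidable using (¬?; _×-dec_; _⊎-dec_; _→-dec_)
open import Relation.Unary using (Decidable)
open import Relation.Binary.PropositionalEquality using (_≡_; _≢_; refl; sym; trans; cong; subst; subst₂)

subsetOf : ∀ {m} {P : Fin m → Set} → Decidable P → Subset m
subsetOf {zero}  P? = []
subsetOf {suc m} P? = does (P? zero) ∷ subsetOf (λ x → P? (suc x))

∈-subsetOf⁺ : ∀ {m} {P : Fin m → Set} (P? : Decidable P) {x} → P x → x ∈ subsetOf P?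
∈-subsetOf⁺ P? {zero} p with P? zero
... | yes _ = here
... | no ¬p = ⊥-elim (¬p p)
∈-subsetOf⁺ P? {suc x} p = there (∈-subsetOf⁺ (λ y → P? (suc y)) p)

∈-subsetOf⁻ : ∀ {m} {P : Fin m → Set} (P? : Decidable P) {x} → x ∈ subsetOf P? → P x
∈-subsetOf⁻ P? {zero} x∈ with P? zero
... | yes p = p
∈-subsetOf⁻ P? {zero} () | no _
∈-subsetOf⁻ P? {suc x} (there x∈) = ∈-subsetOf⁻ (λ y → P? (suc y)) x∈

injectiveOn⇒∣p∣≤∣q∣ : ∀ {a b} {p : Subset a} {q : Subset b} (f : Fin a → Fin b) →
  (∀ {x} → x ∈ p → f x ∈ q) → (∀ {x y} → x ∈ p → y ∈ p → f x ≡ f y → x ≡ y) →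
  ∣ p ∣ ≤ ∣ q ∣
injectiveOn⇒∣p∣≤∣q∣ {p = []} f _ _ = z≤n
injectiveOn⇒∣p∣≤∣q∣ {p = outside ∷ p} f into inj =
  injectiveOn⇒∣p∣≤∣q∣ {p = p} (λ x → f (suc x)) (λ x∈ → into (there x∈))
    (λ x∈ y∈ e → Fin.suc-injective (inj (there x∈) (there y∈) e))
injectiveOn⇒∣p∣≤∣q∣ {p = inside ∷ p} {q} f into inj =
  ℕ.≤-trans (s≤s (injectiveOn⇒∣p∣≤∣q∣ {p = p} {q - f zero} (λ x → f (suc x))
      (λ x∈ → x∈p∧x≢y⇒x∈p-y (into (there x∈)) (λ e → suc≢zero (inj (there x∈) here e)))
      (λ x∈ y∈ e → Fin.suc-injective (inj (there x∈) (there y∈) e))))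
    (x∈p⇒∣p-x∣<∣p∣ (into here))
  where
  suc≢zero : ∀ {m} {x : Fin m} → suc x ≢ zero
  suc≢zero ()

injectiveOn∁⇒∣∁p∣≤∣∁q∣ : ∀ {a b} {p : Subset a} {q : Subset b} (f : Fin a → Fin b) →
  (∀ {x} → x ∉ p → f x ∉ q) → (∀ {x y} → x ∉ p → y ∉ p → f x ≡ f y → x ≡ y) →
  ∣ ∁ p ∣ ≤ ∣ ∁ q ∣
injectiveOn∁⇒∣∁p∣≤∣∁q∣ f into inj =
  injectiveOn⇒∣p∣≤∣q∣ f (λ x∈ → x∉p⇒x∈∁p (into (x∈∁p⇒x∉p x∈)))
    (λ x∈ y∈ → inj (x∈∁p⇒x∉p x∈) (x∈∁p⇒x∉p y∈))

V : Graph → Set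
V G = Fin (n G)

ClosedAdj : (H : Graph) → V H → V H → Set
ClosedAdj H x y = x ≡ y ⊎ _~_ H x y

Reach-head : ∀ {G P u w} → Reach G P u w → P u
Reach-head (here p)     = p
Reach-head (step p _ _) = p

~⇒≢ : ∀ {G u w} → _~_ G u w → u ≢ w
~⇒≢ {G} u~w refl = ~-irr G u~w

¬complete⇒∃≢ : ∀ {G} → ¬ IsCompleteGraph G → (v : V G) → ∃ λ w → w ≢ v
¬complete⇒∃≢ {G} ¬complete v with Fin.any? (λ w → ¬? (w Fin.≟ v))
... | yes w≢v = w≢v
... | no ¬w≢v = ⊥-elim (¬complete (λ a b a≢b → ⊥-elim (a≢b (trans (all≡v a) (sym (all≡v b))))))
  where
  all≡v : ∀ w → w ≡ v
  all≡v w with w Fin.≟ v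
  ... | yes w≡v = w≡v
  ... | no w≢v = ⊥-elim (¬w≢v (w , w≢v))

connected∧¬complete⇒noIsolated : ∀ {G} → Connected G → ¬ IsCompleteGraph G →
  (v : V G) → ∃ λ w → _~_ G v w
connected∧¬complete⇒noIsolated {G} conn ¬complete v
  with w , w≢v ← ¬complete⇒∃≢ {G} ¬complete v
  with conn v w
... | here _       = ⊥-elim (w≢v refl)
... | step _ v~ _  = _ , v~

-- G arises from H by replacing every vertex x by the nonempty clique cls⁻¹(x) of closed twins.
record CliqueBlowup (G H : Graph) : Set where
  field
    cls     : V G → V H
    rep     : V H → V G
    cls-rep : ∀ x → cls (rep x) ≡ x
    adj⇒    : ∀ {u w} → _~_ G u w → ClosedAdj H (cls u) (cls w)
    adj⇐    : ∀ {u w} → u ≢ w → ClosedAdj H (cls u) (cls w) → _~_ G u w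

module CliqueBlowupProperties {G H : Graph} (b : CliqueBlowup G H) where
  open CliqueBlowup b public

  sameClass⇒adj : ∀ {u w} → u ≢ w → cls u ≡ cls w → _~_ G u w
  sameClass⇒adj u≢w e = adj⇐ u≢w (inj₁ e)

  adjᴴ⇒adj : ∀ {u w} → _~_ H (cls u) (cls w) → _~_ G u w
  adjᴴ⇒adj h = adj⇐ (λ u≡w → ~⇒≢ {H} h (cong cls u≡w)) (inj₂ h)

  rep-injective : ∀ {x y} → rep x ≡ rep y → x ≡ y
  rep-injective {x} {y} e = trans (sym (cls-rep x)) (trans (cong cls e) (cls-rep y))

  IsRep : V G → Set
  IsRep v = rep (cls v) ≡ v

  isRep? : Decidable IsRep
  isRep? v = rep (cls v) Fin.≟ v

  rep-isRep : ∀ x → IsRep (rep x)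
  rep-isRep x = cong rep (cls-rep x)

  connected∧¬complete⇒noIsolatedᴴ : Connected G → ¬ IsCompleteGraph G →
    (x : V H) → ∃ λ z → _~_ H x z
  connected∧¬complete⇒noIsolatedᴴ conn ¬complete x =
    leave (conn (rep x) (proj₁ outsider)) (cls-rep x) (proj₂ outsider)
    where
    outsider : ∃ λ w → cls w ≢ x
    outsider with Fin.any? (λ w → ¬? (cls w Fin.≟ x))
    ... | yes p = p
    ... | no ¬p = ⊥-elim (¬complete (λ a b a≢b → sameClass⇒adj a≢b (trans (inX a) (sym (inX b)))))
      where
      inX : ∀ w → cls w ≡ x
      inX w with cls w Fin.≟ x
      ... | yes e = e
      ... | no w∉x = ⊥-elim (¬p (w , w∉x))
    leave : ∀ {P u w} → Reach G P u w → cls u ≡ x → cls w ≢ x → ∃ λ z → _~_ H x z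
    leave (here _) u∈x w∉x = ⊥-elim (w∉x u∈x)
    leave (step {v = v} _ u~v r) u∈x w∉x with cls v Fin.≟ x | adj⇒ u~v
    ... | yes v∈x | _      = leave r v∈x w∉x
    ... | no v∉x  | inj₁ e = ⊥-elim (v∉x (trans (sym e) u∈x))
    ... | no _    | inj₂ h = cls v , subst (λ t → _~_ H t (cls v)) u∈x h

  -- u is adjacent to every twin of w, so any white twin of w would violate the uniqueness of the force.
  forced-lastWhiteOfClass : ∀ {B u w} → ValidForce G B u w →
    ∀ v → cls v ≡ cls w → ¬ B v → v ≡ w
  forced-lastWhiteOfClass {B} {u} {w} (Bu , ¬Bw , u~w , unique) v v∈w ¬Bv with v Fin.≟ w
  ... | yes v≡w = v≡w
  ... | no v≢w  = unique v ¬Bv u~v (step ¬Bw (sameClass⇒adj (λ e → v≢w (sym e)) (sym v∈w)) (here ¬Bv))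
    where
    u~v : _~_ G u v
    u~v with adj⇒ u~w
    ... | inj₁ e = sameClass⇒adj (λ u≡v → ¬Bv (subst B u≡v Bu)) (trans e (sym v∈w))
    ... | inj₂ h = adjᴴ⇒adj (subst (λ t → _~_ H (cls u) t) (sym v∈w) h)

  whiteTwin-neverForced : ∀ fs {B} → ForcingSeq G B fs → ∀ {v v'} → ¬ B v → ¬ B v' → v ≢ v' →
    cls v ≡ cls v' → ¬ (v ∈ₗ map proj₂ fs)
  whiteTwin-neverForced [] _ _ _ _ _ ()
  whiteTwin-neverForced ((u , w) ∷ fs) (vf , rest) {v} {v'} ¬Bv ¬Bv' v≢v' e = go
    where
    v≢w : v ≢ w
    v≢w v≡w = v≢v' (trans v≡w (sym (forced-lastWhiteOfClass vf v' (trans (sym e) (cong cls v≡w)) ¬Bv')))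
    v'≢w : v' ≢ w
    v'≢w v'≡w = v≢v' (trans (forced-lastWhiteOfClass vf v (trans e (cong cls v'≡w)) ¬Bv) (sym v'≡w))
    go : ¬ (v ∈ₗ map proj₂ ((u , w) ∷ fs))
    go (Any.here v≡w) = v≢w v≡w
    go (Any.there m)  = whiteTwin-neverForced fs rest
      (λ { (inj₁ b) → ¬Bv b ; (inj₂ x) → v≢w x }) (λ { (inj₁ b) → ¬Bv' b ; (inj₂ x) → v'≢w x }) v≢v' e m

  pzf-cls-injectiveOnWhite : ∀ {S fs} → IsPZFProcess G S fs →
    ∀ {v v'} → v ∉ S → v' ∉ S → cls v ≡ cls v' → v ≡ v'
  pzf-cls-injectiveOnWhite {fs = fs} (seq , covers) {v} {v'} v∉S v'∉S e with v Fin.≟ v' | covers v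
  ... | yes v≡v' | _      = v≡v'
  ... | no _     | inj₁ v∈S = ⊥-elim (v∉S v∈S)
  ... | no v≢v'  | inj₂ m = ⊥-elim (whiteTwin-neverForced fs seq v∉S v'∉S v≢v' e m)

  LiftsTo : (V H → Set) → (V G → Set) → Set
  LiftsTo Bᴴ B = ∀ v → (B v → ¬ IsRep v ⊎ Bᴴ (cls v)) × (¬ IsRep v ⊎ Bᴴ (cls v) → B v)

  repPair : V H × V H → V G × V G
  repPair (x , y) = rep x , rep y

  module _ {Bᴴ : V H → Set} {B : V G → Set} (li : LiftsTo Bᴴ B) where

    lowerWhitePath : ∀ {a b} → Reach G (λ v → ¬ B v) a b → Reach H (λ x → ¬ Bᴴ x) (cls a) (cls b)
    lowerWhitePath (here ¬Ba) = here (λ Bᴴa → ¬Ba (proj₂ (li _) (inj₂ Bᴴa)))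
    lowerWhitePath {b = b} (step ¬Ba a~v r) with adj⇒ a~v
    ... | inj₁ e = subst (λ t → Reach H (λ x → ¬ Bᴴ x) t (cls b)) (sym e) (lowerWhitePath r)
    ... | inj₂ h = step (λ Bᴴa → ¬Ba (proj₂ (li _) (inj₂ Bᴴa))) h (lowerWhitePath r)

    liftValidForce : ∀ {x y} → ValidForce H Bᴴ x y → ValidForce G B (rep x) (rep y)
    liftValidForce {x} {y} (Bᴴx , ¬Bᴴy , x~y , unique) = Brx , ¬Bry , rx~ry , uniqueG
      where
      Brx : B (rep x)
      Brx = proj₂ (li (rep x)) (inj₂ (subst Bᴴ (sym (cls-rep x)) Bᴴx))
      ¬Bry : ¬ B (rep y)
      ¬Bry Bry with proj₁ (li (rep y)) Bry
      ... | inj₁ ¬rep = ¬rep (rep-isRep y)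
      ... | inj₂ Bᴴy  = ¬Bᴴy (subst Bᴴ (cls-rep y) Bᴴy)
      rx~ry : _~_ G (rep x) (rep y)
      rx~ry = adjᴴ⇒adj (subst₂ (_~_ H) (sym (cls-rep x)) (sym (cls-rep y)) x~y)
      uniqueG : ∀ w → ¬ B w → _~_ G (rep x) w → Reach G (λ v → ¬ B v) (rep y) w → w ≡ rep y
      uniqueG w ¬Bw rx~w r with isRep? w
      ... | no ¬rep = ⊥-elim (¬Bw (proj₂ (li w) (inj₁ ¬rep)))
      ... | yes isRep = trans (sym isRep) (cong rep w∈y)
        where
        ¬Bᴴw : ¬ Bᴴ (cls w)
        ¬Bᴴw Bᴴw = ¬Bw (proj₂ (li w) (inj₂ Bᴴw))
        x~w : _~_ H x (cls w)
        x~w with adj⇒ rx~w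
        ... | inj₁ e = ⊥-elim (¬Bᴴw (subst Bᴴ (trans (sym (cls-rep x)) e) Bᴴx))
        ... | inj₂ h = subst (λ t → _~_ H t (cls w)) (cls-rep x) h
        w∈y : cls w ≡ y
        w∈y = unique (cls w) ¬Bᴴw x~w (subst (λ t → Reach H (λ z → ¬ Bᴴ z) t (cls w)) (cls-rep y) (lowerWhitePath r))

    liftsTo-afterForce : ∀ y → LiftsTo (λ z → Bᴴ z ⊎ z ≡ y) (λ v → B v ⊎ v ≡ rep y)
    liftsTo-afterForce y v = to , from
      where
      to : B v ⊎ v ≡ rep y → ¬ IsRep v ⊎ (Bᴴ (cls v) ⊎ cls v ≡ y)
      to (inj₁ Bv) with proj₁ (li v) Bv
      ... | inj₁ ¬rep = inj₁ ¬rep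
      ... | inj₂ Bᴴv  = inj₂ (inj₁ Bᴴv)
      to (inj₂ v≡ry) = inj₂ (inj₂ (trans (cong cls v≡ry) (cls-rep y)))
      from : ¬ IsRep v ⊎ (Bᴴ (cls v) ⊎ cls v ≡ y) → B v ⊎ v ≡ rep y
      from (inj₁ ¬rep)        = inj₁ (proj₂ (li v) (inj₁ ¬rep))
      from (inj₂ (inj₁ Bᴴv))  = inj₁ (proj₂ (li v) (inj₂ Bᴴv))
      from (inj₂ (inj₂ v∈y)) with isRep? v
      ... | yes isRep = inj₂ (trans (sym isRep) (cong rep v∈y))
      ... | no ¬rep   = inj₁ (proj₂ (li v) (inj₁ ¬rep))

  liftForcingSeq : ∀ fs {Bᴴ B} → LiftsTo Bᴴ B → ForcingSeq H Bᴴ fs → ForcingSeq G B (map repPair fs)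
  liftForcingSeq []             li _           = tt
  liftForcingSeq ((x , y) ∷ fs) {Bᴴ} {B} li (vf , rest) =
    liftValidForce li vf , liftForcingSeq fs (liftsTo-afterForce {Bᴴ} {B} li y) rest

  liftSet : Subset (n H) → Subset (n G)
  liftSet Sᴴ = subsetOf (λ v → ¬? (isRep? v) ⊎-dec (cls v ∈? Sᴴ))

  liftsTo-liftSet : ∀ Sᴴ → LiftsTo (_∈ Sᴴ) (_∈ liftSet Sᴴ)
  liftsTo-liftSet Sᴴ v = ∈-subsetOf⁻ _ , ∈-subsetOf⁺ _

  liftProcess : ∀ {Sᴴ fs} → IsPZFProcess H Sᴴ fs → IsPZFProcess G (liftSet Sᴴ) (map repPair fs)
  liftProcess {Sᴴ} {fs} (seq , covers) = liftForcingSeq fs (liftsTo-liftSet Sᴴ) seq , coversG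
    where
    coversG : ∀ v → v ∈ liftSet Sᴴ ⊎ v ∈ₗ map proj₂ (map repPair fs)
    coversG v with isRep? v | covers (cls v)
    ... | no ¬rep  | _        = inj₁ (proj₂ (liftsTo-liftSet Sᴴ v) (inj₁ ¬rep))
    ... | yes _    | inj₁ v∈S = inj₁ (proj₂ (liftsTo-liftSet Sᴴ v) (inj₂ v∈S))
    ... | yes isRep | inj₂ m with f , f∈fs , v≡ ← ∈-map⁻ proj₂ m =
      inj₂ (subst (_∈ₗ map proj₂ (map repPair fs)) (trans (cong rep (sym v≡)) isRep)
              (∈-map⁺ proj₂ (∈-map⁺ repPair f∈fs)))

  ∣∁Sᴴ∣≤∣∁liftSet∣ : ∀ Sᴴ → ∣ ∁ Sᴴ ∣ ≤ ∣ ∁ (liftSet Sᴴ) ∣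
  ∣∁Sᴴ∣≤∣∁liftSet∣ Sᴴ = injectiveOn∁⇒∣∁p∣≤∣∁q∣ rep rep∉ (λ _ _ → rep-injective)
    where
    rep∉ : ∀ {x} → x ∉ Sᴴ → rep x ∉ liftSet Sᴴ
    rep∉ {x} x∉ rx∈ with proj₁ (liftsTo-liftSet Sᴴ (rep x)) rx∈
    ... | inj₁ ¬rep = ¬rep (rep-isRep x)
    ... | inj₂ rx∈S = x∉ (subst (_∈ Sᴴ) (cls-rep x) rx∈S)

  liftProcess-sameForcingTrees : ∀ Sᴴ fs →
    SameForcingTreesUpToSingletons G H (liftSet Sᴴ) (map repPair fs) Sᴴ fs
  liftProcess-sameForcingTrees Sᴴ fs =
    rep , (λ _ _ → rep-injective) , roots , forces , singletons
    where
    roots : ∀ x → (x ∈ Sᴴ → rep x ∈ liftSet Sᴴ) × (rep x ∈ liftSet Sᴴ → x ∈ Sᴴ)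
    roots x = (λ x∈ → proj₂ (liftsTo-liftSet Sᴴ (rep x)) (inj₂ (subst (_∈ Sᴴ) (sym (cls-rep x)) x∈))) , back
      where
      back : rep x ∈ liftSet Sᴴ → x ∈ Sᴴ
      back rx∈ with proj₁ (liftsTo-liftSet Sᴴ (rep x)) rx∈
      ... | inj₁ ¬rep = ⊥-elim (¬rep (rep-isRep x))
      ... | inj₂ rx∈S = subst (_∈ Sᴴ) (cls-rep x) rx∈S
    forces : ∀ x y → (Forces H fs x y → Forces G (map repPair fs) (rep x) (rep y)) ×
                     (Forces G (map repPair fs) (rep x) (rep y) → Forces H fs x y)
    forces x y = ∈-map⁺ repPair , back
      where
      back : Forces G (map repPair fs) (rep x) (rep y) → Forces H fs x y
      back m with (a , b) , f∈fs , e ← ∈-map⁻ repPair m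
                 with refl ← rep-injective (cong proj₁ e) | refl ← rep-injective (cong proj₂ e) = f∈fs
    singletons : ∀ v → (∀ x → rep x ≢ v) → v ∈ liftSet Sᴴ × (∀ w → ¬ Forces G (map repPair fs) v w)
    singletons v notRep = proj₂ (liftsTo-liftSet Sᴴ v) (inj₁ (notRep (cls v))) , forcesNothing
      where
      forcesNothing : ∀ w → ¬ Forces G (map repPair fs) v w
      forcesNothing w m with (a , _) , _ , e ← ∈-map⁻ repPair m = notRep a (sym (cong proj₁ e))

  module Projection (noIsolatedᴴ : (x : V H) → ∃ λ z → _~_ H x z) where

    -- A force inside a class can only happen once the forced vertex has no white neighbour left;
    -- in H it is then performed by any neighbour of its class.
    forcerᴴ : V G → V G → V H
    forcerᴴ u w with cls u Fin.≟ cls w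
    ... | yes _ = proj₁ (noIsolatedᴴ (cls w))
    ... | no _  = cls u

    projectForce : V G × V G → V H × V H
    projectForce (u , w) = forcerᴴ u w , cls w

    ClassBlack : (V G → Set) → V H → Set
    ClassBlack B x = ∀ v → cls v ≡ x → B v

    ProjectsTo : (V G → Set) → (V H → Set) → Set
    ProjectsTo B Bᴴ = ∀ x → (Bᴴ x → ClassBlack B x) × (ClassBlack B x → Bᴴ x)

    module _ {B : V G → Set} (B? : Decidable B) {Bᴴ : V H → Set} (pr : ProjectsTo B Bᴴ) where

      classBlack : ∀ {x} → (∀ v → cls v ≡ x → ¬ B v → ⊥) → Bᴴ x
      classBlack {x} noWhite = proj₂ (pr x) λ v v∈x → decide v v∈x (B? v)
        where
        decide : ∀ v → cls v ≡ x → Dec (B v) → B v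
        decide v v∈x (yes Bv) = Bv
        decide v v∈x (no ¬Bv) = ⊥-elim (noWhite v v∈x ¬Bv)

      whiteMember : ∀ {x} → ¬ Bᴴ x → ∃ λ v → cls v ≡ x × ¬ B v
      whiteMember {x} ¬Bᴴx with Fin.any? (λ v → (cls v Fin.≟ x) ×-dec ¬? (B? v))
      ... | yes p = p
      ... | no ¬p = ⊥-elim (¬Bᴴx (classBlack (λ v v∈x ¬Bv → ¬p (v , v∈x , ¬Bv))))

      liftWhitePath : ∀ {x y} → Reach H (λ z → ¬ Bᴴ z) x y → ∀ {w} → cls w ≡ x → ¬ B w →
        ∃ λ w' → cls w' ≡ y × ¬ B w' × Reach G (λ v → ¬ B v) w w'
      liftWhitePath (here _) {w} w∈x ¬Bw = w , w∈x , ¬Bw , here ¬Bw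
      liftWhitePath (step _ x~z r) {w} w∈x ¬Bw
        with v , v∈z , ¬Bv ← whiteMember (Reach-head r)
        with w' , w'∈y , ¬Bw' , r' ← liftWhitePath r v∈z ¬Bv =
        w' , w'∈y , ¬Bw' , step ¬Bw (adjᴴ⇒adj (subst₂ (_~_ H) (sym w∈x) (sym v∈z) x~z)) r'

      projectValidForce-acrossClasses : ∀ {u w} → ValidForce G B u w → cls u ≢ cls w →
        ValidForce H Bᴴ (cls u) (cls w)
      projectValidForce-acrossClasses {u} {w} (Bu , ¬Bw , u~w , unique) u∉w =
        classBlack uWhite⇒⊥ , (λ Bᴴw → ¬Bw (proj₁ (pr (cls w)) Bᴴw w refl)) , u~ᴴw , uniqueᴴ
        where
        u~ᴴw : _~_ H (cls u) (cls w)
        u~ᴴw with adj⇒ u~w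
        ... | inj₁ e = ⊥-elim (u∉w e)
        ... | inj₂ h = h
        uWhite⇒⊥ : ∀ v → cls v ≡ cls u → ¬ B v → ⊥
        uWhite⇒⊥ v v∈u ¬Bv = u∉w (trans (sym v∈u) (cong cls v≡w))
          where
          v≡w : v ≡ w
          v≡w = unique v ¬Bv (sameClass⇒adj (λ u≡v → ¬Bv (subst B u≡v Bu)) (sym v∈u))
                  (step ¬Bw (adjᴴ⇒adj (subst (_~_ H (cls w)) (sym v∈u) (~-sym H u~ᴴw))) (here ¬Bv))
        uniqueᴴ : ∀ y → ¬ Bᴴ y → _~_ H (cls u) y → Reach H (λ z → ¬ Bᴴ z) (cls w) y → y ≡ cls w
        uniqueᴴ y _ u~y r with w' , w'∈y , ¬Bw' , r' ← liftWhitePath r refl ¬Bw =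
          trans (sym w'∈y) (cong cls (unique w' ¬Bw' (adjᴴ⇒adj (subst (_~_ H (cls u)) (sym w'∈y) u~y)) r'))

      projectValidForce-withinClass : ∀ {u w} → ValidForce G B u w → cls u ≡ cls w →
        ValidForce H Bᴴ (proj₁ (noIsolatedᴴ (cls w))) (cls w)
      projectValidForce-withinClass {u} {w} (Bu , ¬Bw , u~w , unique) u∈w =
        classBlack zWhite⇒⊥ , (λ Bᴴw → ¬Bw (proj₁ (pr (cls w)) Bᴴw w refl)) , ~-sym H w~z , uniqueᴴ
        where
        z = proj₁ (noIsolatedᴴ (cls w))
        w~z = proj₂ (noIsolatedᴴ (cls w))
        noWhiteNeighbour : ∀ v → ¬ B v → ¬ _~_ G w v
        noWhiteNeighbour v ¬Bv w~v = ~⇒≢ {G} w~v (sym (unique v ¬Bv u~v (step ¬Bw w~v (here ¬Bv))))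
          where
          u~v : _~_ G u v
          u~v with adj⇒ w~v
          ... | inj₁ e = sameClass⇒adj (λ u≡v → ¬Bv (subst B u≡v Bu)) (trans u∈w e)
          ... | inj₂ h = adjᴴ⇒adj (subst (λ t → _~_ H t (cls v)) (sym u∈w) h)
        zWhite⇒⊥ : ∀ v → cls v ≡ z → ¬ B v → ⊥
        zWhite⇒⊥ v v∈z ¬Bv = noWhiteNeighbour v ¬Bv (adjᴴ⇒adj (subst (_~_ H (cls w)) (sym v∈z) w~z))
        uniqueᴴ : ∀ y → ¬ Bᴴ y → _~_ H z y → Reach H (λ x → ¬ Bᴴ x) (cls w) y → y ≡ cls w
        uniqueᴴ y _ _ (here _) = refl
        uniqueᴴ y _ _ (step _ w~x r) with v , v∈x , ¬Bv ← whiteMember (Reach-head r) =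
          ⊥-elim (noWhiteNeighbour v ¬Bv (adjᴴ⇒adj (subst (_~_ H (cls w)) (sym v∈x) w~x)))

      projectValidForce : ∀ {u w} → ValidForce G B u w → ValidForce H Bᴴ (forcerᴴ u w) (cls w)
      projectValidForce {u} {w} vf with cls u Fin.≟ cls w
      ... | yes u∈w = projectValidForce-withinClass vf u∈w
      ... | no u∉w  = projectValidForce-acrossClasses vf u∉w

      projectsTo-afterForce : ∀ {u w} → ValidForce G B u w →
        ProjectsTo (λ v → B v ⊎ v ≡ w) (λ x → Bᴴ x ⊎ x ≡ cls w)
      projectsTo-afterForce {u} {w} vf x = to , from
        where
        to : Bᴴ x ⊎ x ≡ cls w → ClassBlack (λ v → B v ⊎ v ≡ w) x
        to (inj₁ Bᴴx) v v∈x = inj₁ (proj₁ (pr x) Bᴴx v v∈x)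
        to (inj₂ x≡w) v v∈x with B? v
        ... | yes Bv = inj₁ Bv
        ... | no ¬Bv = inj₂ (forced-lastWhiteOfClass vf v (trans v∈x x≡w) ¬Bv)
        from : ClassBlack (λ v → B v ⊎ v ≡ w) x → Bᴴ x ⊎ x ≡ cls w
        from black with x Fin.≟ cls w
        ... | yes x≡w = inj₂ x≡w
        ... | no x≢w  = inj₁ (proj₂ (pr x) λ v v∈x → blackBefore v v∈x (black v v∈x))
          where
          blackBefore : ∀ v → cls v ≡ x → B v ⊎ v ≡ w → B v
          blackBefore v v∈x (inj₁ Bv)  = Bv
          blackBefore v v∈x (inj₂ v≡w) = ⊥-elim (x≢w (trans (sym v∈x) (cong cls v≡w)))

    projectForcingSeq : ∀ fs {B} → Decidable B → ∀ {Bᴴ} → ProjectsTo B Bᴴ →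
      ForcingSeq G B fs → ForcingSeq H Bᴴ (map projectForce fs)
    projectForcingSeq []             B? pr _           = tt
    projectForcingSeq ((u , w) ∷ fs) B? pr (vf , rest) =
      projectValidForce B? pr vf ,
      projectForcingSeq fs (λ v → B? v ⊎-dec (v Fin.≟ w)) (projectsTo-afterForce B? pr vf) rest

    blackClasses : Subset (n G) → Subset (n H)
    blackClasses S = subsetOf (λ x → Fin.all? (λ v → (cls v Fin.≟ x) →-dec (v ∈? S)))

    projectsTo-blackClasses : ∀ S → ProjectsTo (_∈ S) (_∈ blackClasses S)
    projectsTo-blackClasses S x = ∈-subsetOf⁻ _ , ∈-subsetOf⁺ _

    projectProcess : ∀ {S fs} → IsPZFProcess G S fs →
      IsPZFProcess H (blackClasses S) (map projectForce fs)
    projectProcess {S} {fs} (seq , covers) =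
      projectForcingSeq fs (_∈? S) (projectsTo-blackClasses S) seq , coversᴴ
      where
      coversᴴ : ∀ x → x ∈ blackClasses S ⊎ x ∈ₗ map proj₂ (map projectForce fs)
      coversᴴ x with x ∈? blackClasses S
      ... | yes x∈ = inj₁ x∈
      ... | no x∉
        with v , v∈x , v∉S ← whiteMember (_∈? S) (projectsTo-blackClasses S) x∉
        with covers v
      ...   | inj₁ v∈S = ⊥-elim (v∉S v∈S)
      ...   | inj₂ m with f , f∈fs , v≡ ← ∈-map⁻ proj₂ m =
        inj₂ (subst (_∈ₗ map proj₂ (map projectForce fs)) (trans (cong cls (sym v≡)) v∈x)
                (∈-map⁺ proj₂ (∈-map⁺ projectForce f∈fs)))

    ∣∁S∣≤∣∁blackClasses∣ : ∀ {S fs} → IsPZFProcess G S fs → ∣ ∁ S ∣ ≤ ∣ ∁ (blackClasses S) ∣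
    ∣∁S∣≤∣∁blackClasses∣ {S} proc = injectiveOn∁⇒∣∁p∣≤∣∁q∣ cls
      (λ {v} v∉S black → v∉S (proj₁ (projectsTo-blackClasses S (cls v)) black v refl))
      (pzf-cls-injectiveOnWhite proc)

ZplusCorrespondence : (G H : Graph) (k k' : ℕ) → Set
ZplusCorrespondence G H k k' =
  (n G ∸ k ≡ n H ∸ k') ×
  (∃ λ SG → ∃ λ fsG → ∃ λ SH → ∃ λ fsH →
    ∣ SG ∣ ≡ k × IsPZFProcess G SG fsG ×
    ∣ SH ∣ ≡ k' × IsPZFProcess H SH fsH ×
    SameForcingTreesUpToSingletons G H SG fsG SH fsH)

cliqueBlowup-zplusCorrespondence : ∀ {G H} → CliqueBlowup G H → ((x : V H) → ∃ λ z → _~_ H x z) →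
  ∀ {k k'} → IsZplus G k → IsZplus H k' → ZplusCorrespondence G H k k'
cliqueBlowup-zplusCorrespondence {G} {H} b noIsolatedᴴ {k} {k'}
  ((S , ∣S∣≡k , fs , proc) , minimalG) ((Sᴴ , ∣Sᴴ∣≡k' , fsᴴ , procᴴ) , minimalH) =
  n∸k≡n∸k' , liftSet Sᴴ , map repPair fsᴴ , Sᴴ , fsᴴ ,
  ∣liftSet∣≡k , liftProcess procᴴ , ∣Sᴴ∣≡k' , procᴴ , liftProcess-sameForcingTrees Sᴴ fsᴴ
  where
  open CliqueBlowupProperties b
  open Projection noIsolatedᴴ
  open ℕ.≤-Reasoning

  k≤∣liftSet∣ : k ≤ ∣ liftSet Sᴴ ∣
  k≤∣liftSet∣ = minimalG _ (_ , liftProcess procᴴ)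

  whiteG≤whiteH : n G ∸ k ≤ n H ∸ k'
  whiteG≤whiteH = begin
    n G ∸ k                   ≡⟨ cong (n G ∸_) (sym ∣S∣≡k) ⟩
    n G ∸ ∣ S ∣               ≡⟨ ∣∁p∣≡n∸∣p∣ S ⟨
    ∣ ∁ S ∣                   ≤⟨ ∣∁S∣≤∣∁blackClasses∣ proc ⟩
    ∣ ∁ (blackClasses S) ∣    ≡⟨ ∣∁p∣≡n∸∣p∣ (blackClasses S) ⟩
    n H ∸ ∣ blackClasses S ∣  ≤⟨ ℕ.∸-monoʳ-≤ (n H) (minimalH _ (_ , projectProcess proc)) ⟩
    n H ∸ k'                  ∎

  whiteH≤whiteLift : n H ∸ k' ≤ n G ∸ ∣ liftSet Sᴴ ∣
  whiteH≤whiteLift = begin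
    n H ∸ k'                  ≡⟨ cong (n H ∸_) (sym ∣Sᴴ∣≡k') ⟩
    n H ∸ ∣ Sᴴ ∣              ≡⟨ ∣∁p∣≡n∸∣p∣ Sᴴ ⟨
    ∣ ∁ Sᴴ ∣                  ≤⟨ ∣∁Sᴴ∣≤∣∁liftSet∣ Sᴴ ⟩
    ∣ ∁ (liftSet Sᴴ) ∣        ≡⟨ ∣∁p∣≡n∸∣p∣ (liftSet Sᴴ) ⟩
    n G ∸ ∣ liftSet Sᴴ ∣      ∎

  n∸k≡n∸k' : n G ∸ k ≡ n H ∸ k'
  n∸k≡n∸k' = ℕ.≤-antisym whiteG≤whiteH
    (ℕ.≤-trans whiteH≤whiteLift (ℕ.∸-monoʳ-≤ (n G) k≤∣liftSet∣))

  ∣liftSet∣≡k : ∣ liftSet Sᴴ ∣ ≡ k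
  ∣liftSet∣≡k = ℕ.≤-antisym
    (ℕ.∸-cancelʳ-≤ (∣p∣≤n (liftSet Sᴴ)) (ℕ.≤-trans whiteG≤whiteH whiteH≤whiteLift)) k≤∣liftSet∣

module CompressedCliquesGraphProperties {G : Graph} {ℓ : ℕ} {C : Fin ℓ → Subset (n G)}
  (cov : IsCliqueCovering G ℓ C) (si : SimpleIntersection G ℓ C) where

  InCell : Fin ℓ × Fin ℓ → V G → Set
  InCell (i , j) v = InCij G ℓ C i j v

  InCij⇒∈Cᵢ×∈Cⱼ : ∀ {i j v} → InCij G ℓ C i j v → v ∈ C i × v ∈ C j
  InCij⇒∈Cᵢ×∈Cⱼ (inj₁ (refl , v∈Cᵢ , _)) = v∈Cᵢ , v∈Cᵢ
  InCij⇒∈Cᵢ×∈Cⱼ (inj₂ (_ , v∈Cᵢ , v∈Cⱼ)) = v∈Cᵢ , v∈Cⱼ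

  InCij∧∈Cₖ⇒k≡i⊎k≡j : ∀ {i j v k} → InCij G ℓ C i j v → v ∈ C k → k ≡ i ⊎ k ≡ j
  InCij∧∈Cₖ⇒k≡i⊎k≡j {i} {k = k} (inj₁ (refl , _ , onlyCᵢ)) v∈Cₖ with k Fin.≟ i
  ... | yes k≡i = inj₁ k≡i
  ... | no k≢i  = ⊥-elim (onlyCᵢ k k≢i v∈Cₖ)
  InCij∧∈Cₖ⇒k≡i⊎k≡j {i} {j} {v} {k} (inj₂ (i≢j , v∈Cᵢ , v∈Cⱼ)) v∈Cₖ with k Fin.≟ i | k Fin.≟ j
  ... | yes k≡i | _       = inj₁ k≡i
  ... | no _    | yes k≡j = inj₂ k≡j
  ... | no k≢i  | no k≢j  = ⊥-elim (si v i j k i≢j (λ e → k≢j (sym e)) (λ e → k≢i (sym e)) v∈Cᵢ v∈Cⱼ v∈Cₖ)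

  -- A diagonal cell C_{i,i} meets no other clique, and C_{i,j} (i ≠ j) meets only C_i and C_j.
  cell-unique : ∀ {i j i' j' v} → InCij G ℓ C i j v → InCij G ℓ C i' j' v → i ≤F j → i' ≤F j' →
    (i , j) ≡ (i' , j')
  cell-unique v∈ii@(inj₁ (refl , _)) v∈i'j' _ _
    with InCij⇒∈Cᵢ×∈Cⱼ v∈i'j'
  ... | v∈Cᵢ' , v∈Cⱼ' with InCij∧∈Cₖ⇒k≡i⊎k≡j v∈ii v∈Cᵢ' | InCij∧∈Cₖ⇒k≡i⊎k≡j v∈ii v∈Cⱼ'
  ... | inj₁ refl | inj₁ refl = refl
  ... | inj₁ refl | inj₂ refl = refl
  ... | inj₂ refl | inj₁ refl = refl
  ... | inj₂ refl | inj₂ refl = refl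
  cell-unique v∈ij@(inj₂ _) v∈i'i'@(inj₁ (refl , _)) _ _
    with InCij⇒∈Cᵢ×∈Cⱼ v∈ij
  ... | v∈Cᵢ , v∈Cⱼ with InCij∧∈Cₖ⇒k≡i⊎k≡j v∈i'i' v∈Cᵢ | InCij∧∈Cₖ⇒k≡i⊎k≡j v∈i'i' v∈Cⱼ
  ... | inj₁ refl | inj₁ refl = refl
  ... | inj₁ refl | inj₂ refl = refl
  ... | inj₂ refl | inj₁ refl = refl
  ... | inj₂ refl | inj₂ refl = refl
  cell-unique v∈ij@(inj₂ (i≢j , _)) (inj₂ (i'≢j' , v∈Cᵢ' , v∈Cⱼ')) i≤j i'≤j'
    with InCij∧∈Cₖ⇒k≡i⊎k≡j v∈ij v∈Cᵢ' | InCij∧∈Cₖ⇒k≡i⊎k≡j v∈ij v∈Cⱼ'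
  ... | inj₁ refl | inj₂ refl = refl
  ... | inj₂ refl | inj₁ refl = ⊥-elim (i≢j (Fin.≤-antisym i≤j i'≤j'))
  ... | inj₁ refl | inj₁ refl = ⊥-elim (i'≢j' refl)
  ... | inj₂ refl | inj₂ refl = ⊥-elim (i'≢j' refl)

  cell-exists : ∀ {v i} → v ∈ C i → ∃ λ p → proj₁ p ≤F proj₂ p × InCell p v
  cell-exists {v} {i} v∈Cᵢ with Fin.any? (λ j → ¬? (j Fin.≟ i) ×-dec (v ∈? C j))
  ... | no ¬other = (i , i) , Fin.≤-refl , inj₁ (refl , v∈Cᵢ , λ k k≢i v∈Cₖ → ¬other (k , k≢i , v∈Cₖ))
  ... | yes (j , j≢i , v∈Cⱼ) with Fin.≤-total i j
  ...   | inj₁ i≤j = (i , j) , i≤j , inj₂ ((λ e → j≢i (sym e)) , v∈Cᵢ , v∈Cⱼ)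
  ...   | inj₂ j≤i = (j , i) , j≤i , inj₂ (j≢i , v∈Cⱼ , v∈Cᵢ)

  sharesIndex⇒adj : ∀ {p q u w} → InCell p u → InCell q w → u ≢ w → SharesIndex p q → _~_ G u w
  sharesIndex⇒adj {p} {q} {u} {w} u∈p w∈q u≢w shared with InCij⇒∈Cᵢ×∈Cⱼ u∈p | InCij⇒∈Cᵢ×∈Cⱼ w∈q
  ... | u∈Cᵢ , u∈Cⱼ | w∈Cᵢ' , w∈Cⱼ' = inCommonClique shared
    where
    adjIn : ∀ {k k'} → u ∈ C k → k ≡ k' → w ∈ C k' → _~_ G u w
    adjIn {k} u∈Cₖ refl w∈Cₖ = proj₁ cov k u w u∈Cₖ w∈Cₖ u≢w
    inCommonClique : SharesIndex p q → _~_ G u w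
    inCommonClique (inj₁ e)               = adjIn u∈Cᵢ e w∈Cᵢ'
    inCommonClique (inj₂ (inj₁ e))        = adjIn u∈Cᵢ e w∈Cⱼ'
    inCommonClique (inj₂ (inj₂ (inj₁ e))) = adjIn u∈Cⱼ e w∈Cᵢ'
    inCommonClique (inj₂ (inj₂ (inj₂ e))) = adjIn u∈Cⱼ e w∈Cⱼ'

  adj⇒sharesIndex : ∀ {p q u w} → _~_ G u w → InCell p u → InCell q w → SharesIndex p q
  adj⇒sharesIndex {u = u} {w} u~w u∈p w∈q
    with k , u∈Cₖ , w∈Cₖ ← proj₂ cov u w u~w
    with InCij∧∈Cₖ⇒k≡i⊎k≡j u∈p u∈Cₖ | InCij∧∈Cₖ⇒k≡i⊎k≡j w∈q w∈Cₖ
  ... | inj₁ e | inj₁ e' = inj₁ (trans (sym e) e')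
  ... | inj₁ e | inj₂ e' = inj₂ (inj₁ (trans (sym e) e'))
  ... | inj₂ e | inj₁ e' = inj₂ (inj₂ (inj₁ (trans (sym e) e')))
  ... | inj₂ e | inj₂ e' = inj₂ (inj₂ (inj₂ (trans (sym e) e')))

  compressedCliquesGraph⇒cliqueBlowup : ∀ {H} → (∀ v → ∃ λ i → v ∈ C i) →
    IsCompressedCliquesGraph G ℓ C H → CliqueBlowup G H
  compressedCliquesGraph⇒cliqueBlowup {H} inClique cc = record
    { cls = cls ; rep = rep ; cls-rep = cls-rep ; adj⇒ = adjᴳ⇒ ; adj⇐ = adjᴳ⇐ }
    where
    open IsCompressedCliquesGraph cc

    cell : ∀ v → ∃ λ p → proj₁ p ≤F proj₂ p × InCell p v
    cell v = cell-exists (proj₂ (inClique v))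

    vertexOfCell : ∀ v → ∃ λ x → lab x ≡ proj₁ (cell v)
    vertexOfCell v = lab-surjective _ _ (proj₁ (proj₂ (cell v))) (v , proj₂ (proj₂ (cell v)))

    cls : V G → V H
    cls v = proj₁ (vertexOfCell v)

    ∈cls : ∀ v → InCell (lab (cls v)) v
    ∈cls v = subst (λ p → InCell p v) (sym (proj₂ (vertexOfCell v))) (proj₂ (proj₂ (cell v)))

    rep : V H → V G
    rep x = proj₁ (lab-nonempty x)

    cls-rep : ∀ x → cls (rep x) ≡ x
    cls-rep x = lab-injective _ _
      (cell-unique (∈cls (rep x)) (proj₂ (lab-nonempty x)) (lab-ordered _) (lab-ordered x))

    adjᴳ⇒ : ∀ {u w} → _~_ G u w → ClosedAdj H (cls u) (cls w)
    adjᴳ⇒ {u} {w} u~w with cls u Fin.≟ cls w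
    ... | yes e   = inj₁ e
    ... | no u≢w  = inj₂ (adj⇐ _ _ u≢w (adj⇒sharesIndex u~w (∈cls u) (∈cls w)))

    adjᴳ⇐ : ∀ {u w} → u ≢ w → ClosedAdj H (cls u) (cls w) → _~_ G u w
    adjᴳ⇐ {u} {w} u≢w (inj₁ e) =
      sharesIndex⇒adj (∈cls u) (∈cls w) u≢w (subst (λ y → SharesIndex (lab (cls u)) (lab y)) e (inj₁ refl))
    adjᴳ⇐ {u} {w} u≢w (inj₂ h) = sharesIndex⇒adj (∈cls u) (∈cls w) u≢w (proj₂ (adj⇒ _ _ h))

theorem7p4 : (G : Graph) → Connected G → ¬ IsCompleteGraph G →
    (ℓ : ℕ) (C : Fin ℓ → Subset (n G)) →
    IsMinMaxCliqueCovering G ℓ C → SimpleIntersection G ℓ C →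
    (H : Graph) → IsCompressedCliquesGraph G ℓ C H →
    (k k' : ℕ) → IsZplus G k → IsZplus H k' →
    (n G ∸ k ≡ n H ∸ k') ×
    (∃ λ SG → ∃ λ fsG → ∃ λ SH → ∃ λ fsH →
      ∣ SG ∣ ≡ k × IsPZFProcess G SG fsG ×
      ∣ SH ∣ ≡ k' × IsPZFProcess H SH fsH ×
      SameForcingTreesUpToSingletons G H SG fsG SH fsH)
theorem7p4 G conn ¬complete ℓ C (covering , _ , _) simple H cc k k' zplusG zplusH =
  cliqueBlowup-zplusCorrespondence blowup
    (connected∧¬complete⇒noIsolatedᴴ conn ¬complete) zplusG zplusH
  where
  open CompressedCliquesGraphProperties covering simple

  inClique : ∀ v → ∃ λ i → v ∈ C i
  inClique v with w , v~w ← connected∧¬complete⇒noIsolated conn ¬complete v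
             with i , v∈Cᵢ , _ ← proj₂ covering v w v~w = i , v∈Cᵢ

  blowup : CliqueBlowup G H
  blowup = compressedCliquesGraph⇒cliqueBlowup inClique cc

  open CliqueBlowupProperties blowup
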